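{- Let $G$ be a graph with $mad(G)<\frac{14}{5}$ and $ch_3^d(G)\ge 8$ having the smallest number of vertices and edges among all such graphs. Then for $k\in\{3,4\}$, every vertex of degree $k$ in $G$ has at most $k-2$ neighbors of degree $2$.
   Context: A 3-dynamic coloring of a graph $G$ is a proper vertex coloring such that every vertex $v$ sees at least $\min\{3,\deg_G(v)\}$ distinct colors in $N_G(v)$. $ch_3^d(G)$ is the least $k$ such that for every list assignment $L$ with $|L(v)|\ge k$ for all $v$, $G$ has a 3-dynamic coloring $\phi$ with $\phi(v)\in L(v)$ for all $v$. $mad(G)$ is the maximum of $2|E(H)|/|V(H)|$ over nonempty subgraphs $H$ of $G$. -}

module Defs where

open import Data.Bool using (Bool; true; false; T; _∧_)
open import Data.Nat using (ℕ; _+_; _*_; _∸_; _≤_; _<_; _⊓_; ⌊_/2⌋)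
import Data.Nat.Properties as ℕP
open import Data.Fin using (Fin)
open import Data.List using (List; length; filterᵇ; map; concatMap; deduplicate)
open import Data.List.Relation.Unary.Unique.Propositional using (Unique)
open import Data.Product using (Σ; ∃; _×_)
open import Data.Empty using (⊥)
open import Relation.Nullary using (¬_)
open import Relation.Binary.PropositionalEquality using (_≡_; _≢_)
open import Data.Vec.Functional using () 
open import Data.List using () renaming (allFin to allFinL)

record Graph : Set where
  field
    n     : ℕ
    adj   : Fin n → Fin n → Bool
    sym   : ∀ u v → adj u v ≡ adj v u
    irrefl : ∀ v → adj v v ≡ false
open Graph public

vertices : (G : Graph) → List (Fin (n G))
vertices G = allFinL (n G)

nbrs : (G : Graph) → Fin (n G) → List (Fin (n G))
nbrs G v = filterᵇ (adj G v) (vertices G)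

deg : (G : Graph) → Fin (n G) → ℕ
deg G v = length (nbrs G v)

-- number of ordered pairs (u , v) with u ~ v, i.e. 2|E(G)|
twiceEdges : Graph → ℕ
twiceEdges G = length (concatMap (nbrs G) (vertices G))

numV : Graph → ℕ
numV G = n G

numE : Graph → ℕ
numE G = ⌊ twiceEdges G /2⌋

-- Maximum average degree:  mad(G) < 14/5.
-- A subgraph H of G is given by a vertex set S (as a Bool predicate)
-- and an edge set F (symmetric Bool relation) with F ⊆ E(G) and every
-- edge of F having both ends in S.  |V(H)| = |S|, 2|E(H)| = #ordered
-- pairs in F.  mad(G) < 14/5 iff for every nonempty subgraph H,
-- 2|E(H)| / |V(H)| < 14/5, i.e. 5 * 2|E(H)| < 14 * |V(H)|.

record Subgraph (G : Graph) : Set where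
  field
    S      : Fin (n G) → Bool
    F      : Fin (n G) → Fin (n G) → Bool
    F-sym  : ∀ u v → F u v ≡ F v u
    F⊆E    : ∀ u v → T (F u v) → T (adj G u v)
    F-ends : ∀ u v → T (F u v) → T (S u)
open Subgraph public

subV : (G : Graph) → Subgraph G → ℕ
subV G H = length (filterᵇ (S H) (vertices G))

subTwiceE : (G : Graph) → Subgraph G → ℕ
subTwiceE G H = length (concatMap (λ u → filterᵇ (F H u) (vertices G)) (vertices G))

madLt14/5 : Graph → Set
madLt14/5 G = (H : Subgraph G) → 1 ≤ subV G H → 5 * subTwiceE G H < 14 * subV G H

numColoursSeen : (G : Graph) → (Fin (n G) → ℕ) → Fin (n G) → ℕ
numColoursSeen G φ v = length (deduplicate ℕP._≟_ (map φ (nbrs G v)))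

Is3Dynamic : (G : Graph) → (Fin (n G) → ℕ) → Set
Is3Dynamic G φ =
  (∀ u v → T (adj G u v) → φ u ≢ φ v) ×
  (∀ v → 3 ⊓ deg G v ≤ numColoursSeen G φ v)

open import Data.List.Membership.Propositional using (_∈_)

DynChoosable : ℕ → Graph → Set
DynChoosable k G =
  (L : Fin (n G) → List ℕ) →
  (∀ v → Unique (L v) × k ≤ length (L v)) →
  Σ (Fin (n G) → ℕ) λ φ → Is3Dynamic G φ × (∀ v → φ v ∈ L v)

ch3d≥ : Graph → ℕ → Set
ch3d≥ G k = ∀ k' → k' < k → ¬ DynChoosable k' G

Bad : Graph → Set
Bad G = madLt14/5 G × ch3d≥ G 8

MinimalBad : Graph → Set
MinimalBad G = Bad G × (∀ G' → Bad G' → numV G + numE G ≤ numV G' + numE G')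

deg2Nbrs : (G : Graph) → Fin (n G) → ℕ
deg2Nbrs G v = length (filterᵇ (λ u → isTwo (deg G u)) (nbrs G v))
  where
  isTwo : ℕ → Bool
  isTwo 2 = true
  isTwo _ = false

module Submission where

-- Let v have degree k ∈ {3, 4} and at least k − 1 neighbours of degree 2, hence at most one other
-- neighbour. Deleting all edges at v and at its degree-2 neighbours keeps mad < 14/5 and loses edges, so
-- by minimality the smaller graph is 3-dynamically 7-choosable. Take such a colouring, uncolour v and its
-- degree-2 neighbours, and recolour them greedily, v first. When r is coloured, each neighbour y of r
-- rules out its own colour and, if it sees fewer than three colours, the colours it sees: at most three
-- colours, and at most one for an uncoloured degree-2 neighbour of v (it has one coloured neighbour).
-- So v meets at most (k − 1) + 3 ≤ 6 forbidden colours and each degree-2 vertex at most 2 · 3 = 6; a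
-- list of 7 always leaves a colour, making G 3-dynamically 7-choosable, contrary to ch₃ᵈ(G) ≥ 8.

open import Data.Bool using (Bool; true; false; T; not; _∧_; _∨_; T?; if_then_else_)
open import Data.Bool.Properties using (∧-comm; ∧-zeroʳ; ¬-not; T-∧; T-∨; T-≡; T-not-≡)
open import Data.Empty using (⊥; ⊥-elim)
open import Data.Fin using (Fin)
import Data.Fin.Properties as Fin
open import Data.List
  using (List; []; _∷_; _++_; length; map; filter; filterᵇ; concatMap; mapMaybe; deduplicate; fromMaybe)
open import Data.List.Membership.Propositional using (_∈_; _∉_; find; lose)
open import Data.List.Membership.Propositional.Properties
  using ( ∈-filter⁺; ∈-filter⁻; ∈-allFin; ∈-map⁺; ∈-concat⁺′; ∈-++⁺ˡ; ∈-++⁺ʳ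
        ; ∈-deduplicate⁺; ∈-deduplicate⁻)
open import Data.List.Properties
  using (length-++; length-map; length-deduplicate; filter-notAll; mapMaybe-cong; mapMaybe-map; mapMaybe-just)
open import Data.List.Relation.Binary.Permutation.Propositional
  using (_↭_; prep; swap; ↭-refl; ↭-trans; ↭-sym; ↭-reflexive)
open import Data.List.Relation.Binary.Permutation.Propositional.Properties using (↭-length; ∈-resp-↭)
open import Data.List.Relation.Binary.Subset.Propositional using (_⊆_)
import Data.List.Relation.Unary.All as All
open import Data.List.Relation.Unary.AllPairs using (_∷_)
open import Data.List.Relation.Unary.Any using (here; there; any?)
import Data.List.Relation.Unary.Any as Any
open import Data.List.Relation.Unary.Unique.Propositional using (Unique)
open import Data.List.Relation.Unary.Unique.Propositional.Properties using (allFin⁺; filter⁺)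
open import Data.List.Relation.Unary.Unique.DecPropositional.Properties using (deduplicate-!)
open import Data.Maybe using (Maybe; just; nothing; maybe′)
import Data.Maybe.Properties as Maybe
open import Data.Nat using (ℕ; suc; _+_; _*_; _∸_; _≤_; _<_; _⊓_; z≤n; s≤s; _≤?_; _<?_)
open import Data.Nat.Properties
open import Algebra.Properties.CommutativeSemigroup +-commutativeSemigroup using (x∙yz≈y∙xz)
open import Data.Product using (Σ; ∃; _×_; _,_; proj₁; proj₂)
open import Data.Sum using (_⊎_; inj₁; inj₂)
open import Data.Unit using (tt)
open import Data.Vec.Functional using (updateAt)
open import Data.Vec.Functional.Properties using (updateAt-updates; updateAt-minimal)
open import Defs
open import Function using (_∘_; const; id)
open import Function.Bundles using (Equivalence)
open import Relation.Binary.Definitions using (DecidableEquality)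
open import Relation.Binary.PropositionalEquality using (_≡_; _≢_; refl; cong; cong₂; subst; subst₂)
import Relation.Binary.PropositionalEquality as ≡
open import Relation.Nullary using (¬_; yes; no)
open import Relation.Nullary.Decidable using (isYes; ¬?; decidable-stable)

module _ {A : Set} where

  filterᵇ-cong : {p q : A → Bool} → (∀ x → p x ≡ q x) → (xs : List A) → filterᵇ p xs ≡ filterᵇ q xs
  filterᵇ-cong e [] = refl
  filterᵇ-cong {p} {q} e (x ∷ xs) rewrite e x with q x
  ... | true  = cong (x ∷_) (filterᵇ-cong e xs)
  ... | false = filterᵇ-cong e xs

  filterᵇ-const-false : (xs : List A) → filterᵇ (λ _ → false) xs ≡ []
  filterᵇ-const-false [] = refl
  filterᵇ-const-false (x ∷ xs) = filterᵇ-const-false xs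

  filterᵇ-filterᵇ : (p q : A → Bool) (xs : List A) →
                    filterᵇ q (filterᵇ p xs) ≡ filterᵇ (λ x → p x ∧ q x) xs
  filterᵇ-filterᵇ p q [] = refl
  filterᵇ-filterᵇ p q (x ∷ xs) with p x
  ... | false = filterᵇ-filterᵇ p q xs
  ... | true with q x
  ...   | true  = cong (x ∷_) (filterᵇ-filterᵇ p q xs)
  ...   | false = filterᵇ-filterᵇ p q xs

  length-filterᵇ-split : (p : A → Bool) (xs : List A) →
                         length xs ≡ length (filterᵇ p xs) + length (filterᵇ (not ∘ p) xs)
  length-filterᵇ-split p [] = refl
  length-filterᵇ-split p (x ∷ xs) with p x
  ... | true  = cong suc (length-filterᵇ-split p xs)
  ... | false = ≡.trans (cong suc (length-filterᵇ-split p xs)) (≡.sym (+-suc _ _))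

  length-filterᵇ-mono : {p q : A → Bool} (xs : List A) → (∀ x → x ∈ xs → T (p x) → T (q x)) →
                        length (filterᵇ p xs) ≤ length (filterᵇ q xs)
  length-filterᵇ-mono [] p⇒q = z≤n
  length-filterᵇ-mono {p} {q} (x ∷ xs) p⇒q
    with ih ← length-filterᵇ-mono xs (λ y y∈xs → p⇒q y (there y∈xs)) | p x in px | q x in qx
  ... | true  | true  = s≤s ih
  ... | true  | false = ⊥-elim (subst T qx (p⇒q x (here refl) (subst T (≡.sym px) tt)))
  ... | false | true  = m≤n⇒m≤1+n ih
  ... | false | false = ih


  belowThree : List A → List A
  belowThree cs with length cs <? 3
  ... | yes _ = cs
  ... | no _  = []

  length-belowThree≤2 : (cs : List A) → length (belowThree cs) ≤ 2
  length-belowThree≤2 cs with length cs <? 3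
  ... | yes (s≤s <3) = <3
  ... | no _         = z≤n

  length-belowThree≤ : (cs : List A) → length (belowThree cs) ≤ length cs
  length-belowThree≤ cs with length cs <? 3
  ... | yes _ = ≤-refl
  ... | no _  = z≤n

  belowThree-id : (cs : List A) → length cs < 3 → belowThree cs ≡ cs
  belowThree-id cs <3 with length cs <? 3
  ... | yes _  = refl
  ... | no ≮3 = ⊥-elim (≮3 <3)

module _ {A B : Set} where

  mapMaybe-if : (R : A → Bool) (φ : A → B) (xs : List A) →
                mapMaybe (λ x → if R x then nothing else just (φ x)) xs ≡ map φ (filterᵇ (not ∘ R) xs)
  mapMaybe-if R φ [] = refl
  mapMaybe-if R φ (x ∷ xs) with R x
  ... | true  = mapMaybe-if R φ xs
  ... | false = cong (φ x ∷_) (mapMaybe-if R φ xs)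

  ∈-concatMap⁺ : (f : A → List B) {x : A} {y : B} {xs : List A} → x ∈ xs → y ∈ f x → y ∈ concatMap f xs
  ∈-concatMap⁺ f x∈xs y∈fx = ∈-concat⁺′ y∈fx (∈-map⁺ f x∈xs)

  length-concatMap-≤ : (f : A → List B) {b : ℕ} → (∀ x → length (f x) ≤ b) →
                       (xs : List A) → length (concatMap f xs) ≤ length xs * b
  length-concatMap-≤ f fx≤b [] = z≤n
  length-concatMap-≤ f fx≤b (x ∷ xs) rewrite length-++ (f x) {concatMap f xs} =
    +-mono-≤ (fx≤b x) (length-concatMap-≤ f fx≤b xs)

  length-concatMap-≤-split : (f : A → List B) (p : A → Bool) {a b : ℕ} (xs : List A) →
                             (∀ x → x ∈ xs → T (p x) → length (f x) ≤ a) → (∀ x → length (f x) ≤ b) →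
                             length (concatMap f xs) ≤
                               length (filterᵇ p xs) * a + length (filterᵇ (not ∘ p) xs) * b
  length-concatMap-≤-split f p [] fx≤a fx≤b = z≤n
  length-concatMap-≤-split f p {a} {b} (x ∷ xs) fx≤a fx≤b
    rewrite length-++ (f x) {concatMap f xs}
    with ih ← length-concatMap-≤-split f p xs (λ y y∈xs → fx≤a y (there y∈xs)) fx≤b | p x in px
  ... | true  = ≤-trans (+-mono-≤ (fx≤a x (here refl) (subst T (≡.sym px) tt)) ih)
                        (≤-reflexive (≡.sym (+-assoc a _ (length (filterᵇ (not ∘ p) xs) * b))))
  ... | false = ≤-trans (+-mono-≤ (fx≤b x) ih)
                        (≤-reflexive (x∙yz≈y∙xz b (length (filterᵇ p xs) * a) _))

  length-concatMap-mono : (f g : A → List B) → (∀ x → length (f x) ≤ length (g x)) →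
                          (xs : List A) → length (concatMap f xs) ≤ length (concatMap g xs)
  length-concatMap-mono f g f≤g [] = z≤n
  length-concatMap-mono f g f≤g (x ∷ xs)
    rewrite length-++ (f x) {concatMap f xs} | length-++ (g x) {concatMap g xs} =
    +-mono-≤ (f≤g x) (length-concatMap-mono f g f≤g xs)

  length-concatMap-gap : (f g : A → List B) → (∀ x → length (f x) ≤ length (g x)) →
                         {d : ℕ} {v : A} {xs : List A} → v ∈ xs → d + length (f v) ≤ length (g v) →
                         d + length (concatMap f xs) ≤ length (concatMap g xs)
  length-concatMap-gap f g f≤g {d} {xs = x ∷ xs} (here refl) gap
    rewrite length-++ (f x) {concatMap f xs} | length-++ (g x) {concatMap g xs} =
    ≤-trans (≤-reflexive (≡.sym (+-assoc d (length (f x)) _)))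
            (+-mono-≤ gap (length-concatMap-mono f g f≤g xs))
  length-concatMap-gap f g f≤g {d} {xs = x ∷ xs} (there v∈xs) gap
    rewrite length-++ (f x) {concatMap f xs} | length-++ (g x) {concatMap g xs} =
    ≤-trans (≤-reflexive (x∙yz≈y∙xz d (length (f x)) _))
            (+-mono-≤ (f≤g x) (length-concatMap-gap f g f≤g v∈xs gap))

module Distinct {A : Set} (_≟_ : DecidableEquality A) where

  open import Data.List.Membership.DecPropositional _≟_ using (_∈?_)

  Unique-⊆⇒length≤ : {xs ys : List A} → Unique xs → xs ⊆ ys → length xs ≤ length ys
  Unique-⊆⇒length≤ {[]} _ _ = z≤n
  Unique-⊆⇒length≤ {x ∷ xs} {ys} (x∉xs ∷ unique) x∷xs⊆ys =
    ≤-trans (s≤s (Unique-⊆⇒length≤ unique xs⊆ys-x)) (filter-notAll (¬? ∘ (x ≟_)) ys x∈ys)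
    where
    xs⊆ys-x : xs ⊆ filter (¬? ∘ (x ≟_)) ys
    xs⊆ys-x z∈xs = ∈-filter⁺ (¬? ∘ (x ≟_)) (x∷xs⊆ys (there z∈xs)) (All.lookup x∉xs z∈xs)
    x∈ys = Any.map (λ x≡y x≢y → x≢y x≡y) (x∷xs⊆ys (here refl))

  ∃-∉ : {xs ys : List A} → Unique xs → length ys < length xs → ∃ λ x → x ∈ xs × x ∉ ys
  ∃-∉ {xs} {ys} unique short with any? (λ x → ¬? (x ∈? ys)) xs
  ... | yes some = find some
  ... | no none  = ⊥-elim (<⇒≱ short (Unique-⊆⇒length≤ unique xs⊆ys))
    where
    xs⊆ys : xs ⊆ ys
    xs⊆ys {x} x∈xs = decidable-stable (x ∈? ys) (λ x∉ys → none (lose x∈xs x∉ys))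

  distinct : List A → ℕ
  distinct xs = length (deduplicate _≟_ xs)

  distinct-mono : {xs ys : List A} → xs ⊆ ys → distinct xs ≤ distinct ys
  distinct-mono {xs} {ys} xs⊆ys = Unique-⊆⇒length≤ (deduplicate-! _≟_ xs)
    (∈-deduplicate⁺ _≟_ ∘ xs⊆ys ∘ ∈-deduplicate⁻ _≟_ xs)

  distinct-∷-fresh : {x : A} {xs : List A} → x ∉ xs → suc (distinct xs) ≤ distinct (x ∷ xs)
  distinct-∷-fresh {x} {xs} x∉xs = Unique-⊆⇒length≤ {x ∷ deduplicate _≟_ xs}
    (All.tabulate (λ z∈ x≡z → x∉xs (subst (_∈ xs) (≡.sym x≡z) (∈-deduplicate⁻ _≟_ xs z∈)))
      ∷ deduplicate-! _≟_ xs)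
    λ { (here refl) → ∈-deduplicate⁺ _≟_ {x ∷ xs} (here refl)
      ; (there z∈) → ∈-deduplicate⁺ _≟_ (there (∈-deduplicate⁻ _≟_ xs z∈)) }

  Diverse : List A → Set
  Diverse xs = 3 ⊓ length xs ≤ distinct xs

  diverse-short : (xs : List A) → length xs ≤ 1 → Diverse xs
  diverse-short [] _ = z≤n
  diverse-short (x ∷ []) _ = s≤s z≤n
  diverse-short (x ∷ y ∷ xs) (s≤s ())

  diverse-add : {x : A} {xs ys : List A} → Diverse xs → (distinct xs < 3 → x ∉ xs) → ys ↭ x ∷ xs → Diverse ys
  diverse-add {x} {xs} {ys} diverse fresh ys↭ with distinct xs <? 3
  ... | no ≮3 = ≤-trans (m⊓n≤m 3 _) (≤-trans (≮⇒≥ ≮3) (distinct-mono (x∷xs⊆ys ∘ there)))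
    where
    x∷xs⊆ys : x ∷ xs ⊆ ys
    x∷xs⊆ys = ∈-resp-↭ (↭-sym ys↭)
  ... | yes <3 = begin
      3 ⊓ length ys          ≡⟨ cong (3 ⊓_) (↭-length ys↭) ⟩
      3 ⊓ suc (length xs)    ≤⟨ s≤s (⊓-monoˡ-≤ (length xs) (n≤1+n 2)) ⟩
      suc (3 ⊓ length xs)    ≤⟨ s≤s diverse ⟩
      suc (distinct xs)      ≤⟨ distinct-∷-fresh (fresh <3) ⟩
      distinct (x ∷ xs)      ≤⟨ distinct-mono (∈-resp-↭ (↭-sym ys↭)) ⟩
      distinct ys            ∎
    where open ≤-Reasoning

open Distinct Data.Nat.Properties._≟_ using (distinct; Diverse; diverse-short; diverse-add; ∃-∉)

Vertex : Graph → Set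
Vertex G = Fin (n G)

module _ (G : Graph) where

  ∈-nbrs⁺ : {u v : Vertex G} → T (adj G v u) → u ∈ nbrs G v
  ∈-nbrs⁺ {u} {v} = ∈-filter⁺ (T? ∘ adj G v) (∈-allFin u)

  ∈-nbrs⁻ : {u v : Vertex G} → u ∈ nbrs G v → T (adj G v u)
  ∈-nbrs⁻ {v = v} = proj₂ ∘ ∈-filter⁻ (T? ∘ adj G v) {xs = vertices G}

  nbrs-unique : (v : Vertex G) → Unique (nbrs G v)
  nbrs-unique v = filter⁺ (T? ∘ adj G v) {vertices G} (allFin⁺ (n G))

  adj-sym : {u v : Vertex G} → T (adj G u v) → T (adj G v u)
  adj-sym {u} {v} = subst T (sym G u v)

  adj⇒≢ : {u v : Vertex G} → T (adj G u v) → u ≢ v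
  adj⇒≢ {u} u~u refl = subst T (irrefl G u) u~u

isTwo : ℕ → Bool
isTwo 2 = true
isTwo _ = false

isTwo⇒≡2 : {m : ℕ} → T (isTwo m) → m ≡ 2
isTwo⇒≡2 {2} _ = refl

-- Defs hides its degree-2 test in a where clause; it is recovered by unifying against deg2Nbrs itself.
deg2Nbrs-isTwo : (G : Graph) (v : Vertex G) →
                 deg2Nbrs G v ≡ length (filterᵇ (isTwo ∘ deg G) (nbrs G v))
deg2Nbrs-isTwo G v = cong length (filterᵇ-cong agree (nbrs G v))
  where
  testOf : (p : Vertex G → Bool) → deg2Nbrs G v ≡ length (filterᵇ p (nbrs G v)) → Vertex G → Bool
  testOf p _ = p

  deg2Test : Vertex G → Bool
  deg2Test = testOf _ refl

  agree : ∀ u → deg2Test u ≡ isTwo (deg G u)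
  agree u with deg G u
  ... | 0 = refl
  ... | 1 = refl
  ... | 2 = refl
  ... | suc (suc (suc _)) = refl

module _ {m : ℕ} {B : Set} (ψ : Fin m → Maybe B) where

  mapMaybe-updateAt-∉ : (r : Fin m) (f : Maybe B → Maybe B) {xs : List (Fin m)} → r ∉ xs →
                        mapMaybe (updateAt ψ r f) xs ≡ mapMaybe ψ xs
  mapMaybe-updateAt-∉ r f {[]} r∉ = refl
  mapMaybe-updateAt-∉ r f {x ∷ xs} r∉ =
    cong₂ (maybe′ _∷_ id) (updateAt-minimal x r ψ (r∉ ∘ here ∘ ≡.sym))
                          (mapMaybe-updateAt-∉ r f (r∉ ∘ there))

  private
    maybe-∷-↭ : {c : B} (x : Maybe B) {ys zs : List B} → ys ↭ c ∷ zs →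
                maybe′ _∷_ id x ys ↭ c ∷ maybe′ _∷_ id x zs
    maybe-∷-↭ nothing  ys↭ = ys↭
    maybe-∷-↭ {c} (just d) ys↭ = ↭-trans (prep d ys↭) (swap d c ↭-refl)

  mapMaybe-updateAt-∈ : (r : Fin m) (c : B) {xs : List (Fin m)} → Unique xs → r ∈ xs → ψ r ≡ nothing →
                        mapMaybe (updateAt ψ r (const (just c))) xs ↭ c ∷ mapMaybe ψ xs
  mapMaybe-updateAt-∈ r c {r ∷ xs} (r∉xs ∷ _) (here refl) ψr
    rewrite updateAt-updates r {const (just c)} ψ | ψr =
    prep c (↭-reflexive (mapMaybe-updateAt-∉ r _ (λ r∈xs → All.lookup r∉xs r∈xs refl)))
  mapMaybe-updateAt-∈ r c {x ∷ xs} (x∉xs ∷ unique) (there r∈xs) ψr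
    rewrite updateAt-minimal x r {const (just c)} ψ (All.lookup x∉xs r∈xs) =
    maybe-∷-↭ (ψ x) (mapMaybe-updateAt-∈ r c unique r∈xs ψr)

deleteEdgesAt : (G : Graph) → (Vertex G → Bool) → Graph
deleteEdgesAt G R = record
  { n      = n G
  ; adj    = adj′
  ; sym    = λ a b → cong₂ _∧_ (sym G a b) (∧-comm (not (R a)) (not (R b)))
  ; irrefl = λ a → cong (_∧ _) (irrefl G a)
  }
  where
  adj′ : Vertex G → Vertex G → Bool
  adj′ a b = adj G a b ∧ (not (R a) ∧ not (R b))

module _ (G : Graph) (R : Vertex G → Bool) where

  private
    G′ = deleteEdgesAt G R

  deleteEdgesAt-mad : madLt14/5 G → madLt14/5 G′
  deleteEdgesAt-mad madG H = madG record
    { S = S H ; F = F H ; F-sym = F-sym H ; F-ends = F-ends H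
    ; F⊆E = λ a b → proj₁ ∘ Equivalence.to T-∧ ∘ F⊆E H a b }

  nbrs-deleteEdgesAt : (y : Vertex G) → R y ≡ false → nbrs G′ y ≡ filterᵇ (not ∘ R) (nbrs G y)
  nbrs-deleteEdgesAt y Ry =
    ≡.trans (filterᵇ-cong keep (vertices G)) (≡.sym (filterᵇ-filterᵇ (adj G y) (not ∘ R) (vertices G)))
    where
    keep : ∀ z → adj G y z ∧ (not (R y) ∧ not (R z)) ≡ adj G y z ∧ not (R z)
    keep z rewrite Ry = refl

  nbrs-deleteEdgesAt-removed : (v : Vertex G) → R v ≡ true → nbrs G′ v ≡ []
  nbrs-deleteEdgesAt-removed v Rv = ≡.trans (filterᵇ-cong isolated (vertices G)) (filterᵇ-const-false (vertices G))
    where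
    isolated : ∀ z → adj G v z ∧ (not (R v) ∧ not (R z)) ≡ false
    isolated z rewrite Rv = ∧-zeroʳ (adj G v z)

  twiceEdges-deleteEdgesAt : (v : Vertex G) → R v ≡ true → deg G v + twiceEdges G′ ≤ twiceEdges G
  twiceEdges-deleteEdgesAt v Rv = length-concatMap-gap (nbrs G′) (nbrs G) fewer (∈-allFin v)
    (≤-reflexive (≡.trans (cong (λ xs → deg G v + length xs) (nbrs-deleteEdgesAt-removed v Rv)) (+-identityʳ _)))
    where
    fewer : ∀ y → length (nbrs G′ y) ≤ length (nbrs G y)
    fewer y = length-filterᵇ-mono (vertices G) (λ z _ → proj₁ ∘ Equivalence.to T-∧)

PartialColouring : Graph → Set
PartialColouring G = Vertex G → Maybe ℕ

module PartialColourings (G : Graph) (L : Vertex G → List ℕ) where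

  seen : PartialColouring G → Vertex G → List ℕ
  seen ψ y = mapMaybe ψ (nbrs G y)

  record IsPartial3Dynamic (ψ : PartialColouring G) : Set where
    field
      proper    : ∀ a b → T (adj G a b) → ∀ {c} → ψ a ≡ just c → ψ b ≢ just c
      diverse   : ∀ y → Diverse (seen ψ y)
      fromLists : ∀ z {c} → ψ z ≡ just c → c ∈ L z

  Coloured : PartialColouring G → Vertex G → Set
  Coloured ψ z = ∃ λ c → ψ z ≡ just c

  _⊑_ : PartialColouring G → PartialColouring G → Set
  ψ ⊑ ψ′ = ∀ z {c} → ψ z ≡ just c → ψ′ z ≡ just c

  ⊑-trans : {ψ₁ ψ₂ ψ₃ : PartialColouring G} → ψ₁ ⊑ ψ₂ → ψ₂ ⊑ ψ₃ → ψ₁ ⊑ ψ₃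
  ⊑-trans ψ₁⊑ψ₂ ψ₂⊑ψ₃ z = ψ₂⊑ψ₃ z ∘ ψ₁⊑ψ₂ z

  ⊑-Coloured : {ψ ψ′ : PartialColouring G} {z : Vertex G} → ψ ⊑ ψ′ → Coloured ψ z → Coloured ψ′ z
  ⊑-Coloured {z = z} ψ⊑ψ′ (c , ψz) = c , ψ⊑ψ′ z ψz

  -- A colour for r outside blocked ψ y differs from y's colour and, if y sees fewer than three
  -- colours, is new to y.
  blocked : PartialColouring G → Vertex G → List ℕ
  blocked ψ y = fromMaybe (ψ y) ++ belowThree (deduplicate _≟_ (seen ψ y))

  forbidden : PartialColouring G → Vertex G → List ℕ
  forbidden ψ r = concatMap (blocked ψ) (nbrs G r)

  colourAt : PartialColouring G → Vertex G → ℕ → PartialColouring G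
  colourAt ψ r c = updateAt ψ r (const (just c))

  length-blocked≤3 : (ψ : PartialColouring G) (y : Vertex G) → length (blocked ψ y) ≤ 3
  length-blocked≤3 ψ y rewrite length-++ (fromMaybe (ψ y)) {belowThree (deduplicate _≟_ (seen ψ y))}
    with ψ y
  ... | just _  = s≤s (length-belowThree≤2 (deduplicate _≟_ (seen ψ y)))
  ... | nothing = ≤-trans (length-belowThree≤2 (deduplicate _≟_ (seen ψ y))) (n≤1+n 2)

  length-blocked-uncoloured : (ψ : PartialColouring G) (y : Vertex G) → ψ y ≡ nothing →
                              length (blocked ψ y) ≤ length (seen ψ y)
  length-blocked-uncoloured ψ y ψy rewrite ψy =
    ≤-trans (length-belowThree≤ (deduplicate _≟_ (seen ψ y))) (length-deduplicate _≟_ (seen ψ y))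

  length-forbidden≤ : (ψ : PartialColouring G) (r : Vertex G) → length (forbidden ψ r) ≤ deg G r * 3
  length-forbidden≤ ψ r = length-concatMap-≤ (blocked ψ) (length-blocked≤3 ψ) (nbrs G r)

  colour-∈-forbidden : (ψ : PartialColouring G) {r b : Vertex G} {c : ℕ} → T (adj G r b) → ψ b ≡ just c →
                       c ∈ forbidden ψ r
  colour-∈-forbidden ψ {b = b} r~b ψb =
    ∈-concatMap⁺ (blocked ψ) (∈-nbrs⁺ G r~b)
      (∈-++⁺ˡ (subst (λ x → _ ∈ fromMaybe x) (≡.sym ψb) (here refl)))

  seen-⊆-forbidden : (ψ : PartialColouring G) {r y : Vertex G} {c : ℕ} → T (adj G r y) →
                     distinct (seen ψ y) < 3 → c ∈ seen ψ y → c ∈ forbidden ψ r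
  seen-⊆-forbidden ψ {y = y} r~y <3 c∈ =
    ∈-concatMap⁺ (blocked ψ) (∈-nbrs⁺ G r~y)
      (∈-++⁺ʳ (fromMaybe (ψ y)) (subst (_ ∈_) (≡.sym (belowThree-id _ <3)) (∈-deduplicate⁺ _≟_ c∈)))

  colourAt-valid : {ψ : PartialColouring G} {r : Vertex G} {c : ℕ} → IsPartial3Dynamic ψ →
                   ψ r ≡ nothing → c ∈ L r → c ∉ forbidden ψ r → IsPartial3Dynamic (colourAt ψ r c)
  colourAt-valid {ψ} {r} {c} valid ψr c∈L c∉ = record
    { proper = proper′ ; diverse = diverse′ ; fromLists = fromLists′ }
    where
    open IsPartial3Dynamic valid
    ψ′ = colourAt ψ r c

    at-r : ψ′ r ≡ just c
    at-r = updateAt-updates r ψ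

    off-r : {z : Vertex G} → z ≢ r → ψ′ z ≡ ψ z
    off-r {z} = updateAt-minimal z r ψ

    clash-free : {b : Vertex G} → T (adj G r b) → ψ′ b ≢ just c
    clash-free r~b ψ′b =
      c∉ (colour-∈-forbidden ψ r~b (≡.trans (≡.sym (off-r (adj⇒≢ G (adj-sym G r~b)))) ψ′b))

    proper′ : ∀ a b → T (adj G a b) → ∀ {d} → ψ′ a ≡ just d → ψ′ b ≢ just d
    proper′ a b a~b ψ′a ψ′b with a Fin.≟ r | b Fin.≟ r
    ... | yes refl | _        = clash-free a~b (≡.trans ψ′b (≡.trans (≡.sym ψ′a) at-r))
    ... | no _     | yes refl = clash-free (adj-sym G a~b) (≡.trans ψ′a (≡.trans (≡.sym ψ′b) at-r))
    ... | no a≢r   | no b≢r   =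
      proper a b a~b (≡.trans (≡.sym (off-r a≢r)) ψ′a) (≡.trans (≡.sym (off-r b≢r)) ψ′b)

    diverse′ : ∀ y → Diverse (seen ψ′ y)
    diverse′ y with T? (adj G y r)
    ... | no ¬y~r = subst Diverse (≡.sym (mapMaybe-updateAt-∉ ψ r _ (¬y~r ∘ ∈-nbrs⁻ G))) (diverse y)
    ... | yes y~r = diverse-add (diverse y) (λ <3 c∈ → c∉ (seen-⊆-forbidden ψ (adj-sym G y~r) <3 c∈))
                                (mapMaybe-updateAt-∈ ψ r c (nbrs-unique G y) (∈-nbrs⁺ G y~r) ψr)

    fromLists′ : ∀ z {d} → ψ′ z ≡ just d → d ∈ L z
    fromLists′ z ψ′z with z Fin.≟ r
    ... | yes refl = subst (_∈ L r) (Maybe.just-injective (≡.trans (≡.sym at-r) ψ′z)) c∈L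
    ... | no z≢r   = fromLists z (≡.trans (≡.sym (off-r z≢r)) ψ′z)

  colourVertex : {ψ : PartialColouring G} → IsPartial3Dynamic ψ → (r : Vertex G) → Unique (L r) →
                 length (forbidden ψ r) < length (L r) →
                 ∃ λ ψ′ → IsPartial3Dynamic ψ′ × ψ ⊑ ψ′ × Coloured ψ′ r
  colourVertex {ψ} valid r unique room with ψ r in ψr
  ... | just c  = ψ , valid , (λ _ ψz → ψz) , c , ψr
  ... | nothing with c , c∈L , c∉ ← ∃-∉ unique room =
    colourAt ψ r c , colourAt-valid valid ψr c∈L c∉ , extends , c , updateAt-updates r ψ
    where
    extends : ψ ⊑ colourAt ψ r c
    extends z ψz = ≡.trans (updateAt-minimal z r ψ λ { refl → nothing≢just (≡.trans (≡.sym ψr) ψz) }) ψz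
      where
      nothing≢just : {d : ℕ} → nothing ≢ just d
      nothing≢just ()

  colourAll : {ψ : PartialColouring G} → IsPartial3Dynamic ψ → (∀ u → Unique (L u)) →
              (us : List (Vertex G)) → (∀ u → u ∈ us → deg G u * 3 < length (L u)) →
              ∃ λ ψ′ → IsPartial3Dynamic ψ′ × ψ ⊑ ψ′ × (∀ u → u ∈ us → Coloured ψ′ u)
  colourAll valid unique [] room = _ , valid , (λ _ ψz → ψz) , λ _ ()
  colourAll {ψ} valid unique (u ∷ us) room
    with ψ₁ , valid₁ , ψ⊑ψ₁ , u-coloured ←
           colourVertex valid u (unique u) (≤-<-trans (length-forbidden≤ ψ u) (room u (here refl)))
    with ψ₂ , valid₂ , ψ₁⊑ψ₂ , us-coloured ←
           colourAll valid₁ unique us (λ w w∈us → room w (there w∈us)) =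
    ψ₂ , valid₂ , ⊑-trans ψ⊑ψ₁ ψ₁⊑ψ₂ ,
    λ { w (here refl) → ⊑-Coloured ψ₁⊑ψ₂ u-coloured ; w (there w∈us) → us-coloured w w∈us }

  total⇒3Dynamic : {ψ : PartialColouring G} → IsPartial3Dynamic ψ → (∀ z → Coloured ψ z) →
                   Σ (Vertex G → ℕ) λ φ → Is3Dynamic G φ × (∀ z → φ z ∈ L z)
  total⇒3Dynamic {ψ} valid coloured = φ , (proper′ , dynamic) , λ z → fromLists z (colour z)
    where
    open IsPartial3Dynamic valid

    φ : Vertex G → ℕ
    φ z = proj₁ (coloured z)

    colour : ∀ z → ψ z ≡ just (φ z)
    colour z = proj₂ (coloured z)

    seen≡ : ∀ y → seen ψ y ≡ map φ (nbrs G y)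
    seen≡ y = begin
      mapMaybe ψ (nbrs G y)             ≡⟨ mapMaybe-cong colour (nbrs G y) ⟩
      mapMaybe (just ∘ φ) (nbrs G y)    ≡⟨ mapMaybe-map just φ (nbrs G y) ⟨
      mapMaybe just (map φ (nbrs G y))  ≡⟨ mapMaybe-just (map φ (nbrs G y)) ⟩
      map φ (nbrs G y)                  ∎
      where open ≡.≡-Reasoning

    proper′ : ∀ a b → T (adj G a b) → φ a ≢ φ b
    proper′ a b a~b φa≡φb = proper a b a~b (colour a) (≡.trans (colour b) (cong just (≡.sym φa≡φb)))

    dynamic : ∀ y → 3 ⊓ deg G y ≤ numColoursSeen G φ y
    dynamic y = subst (λ k → 3 ⊓ k ≤ numColoursSeen G φ y) (length-map φ (nbrs G y))
                      (subst Diverse (seen≡ y) (diverse y))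

  uncolour : (Vertex G → Bool) → (Vertex G → ℕ) → PartialColouring G
  uncolour R φ z = if R z then nothing else just (φ z)

  uncolour-inside : (R : Vertex G → Bool) (φ : Vertex G → ℕ) {z : Vertex G} → R z ≡ true →
                    uncolour R φ z ≡ nothing
  uncolour-inside R φ Rz rewrite Rz = refl

  uncolour-outside : (R : Vertex G → Bool) (φ : Vertex G → ℕ) {z : Vertex G} → R z ≡ false →
                     uncolour R φ z ≡ just (φ z)
  uncolour-outside R φ Rz rewrite Rz = refl

  uncolour-valid : (R : Vertex G → Bool) {φ : Vertex G → ℕ} → Is3Dynamic (deleteEdgesAt G R) φ →
                   (∀ z → φ z ∈ L z) → (∀ y → R y ≡ true → length (filterᵇ (not ∘ R) (nbrs G y)) ≤ 1) →
                   IsPartial3Dynamic (uncolour R φ)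
  uncolour-valid R {φ} (properG′ , dynamicG′) inL fewOutside = record
    { proper = proper′ ; diverse = diverse′ ; fromLists = fromLists′ }
    where
    uncolour-just : ∀ {z c} → uncolour R φ z ≡ just c → R z ≡ false × φ z ≡ c
    uncolour-just {z} eq with R z | eq
    ... | false | refl = refl , refl

    proper′ : ∀ a b → T (adj G a b) → ∀ {c} → uncolour R φ a ≡ just c → uncolour R φ b ≢ just c
    proper′ a b a~b ψa ψb with uncolour-just ψa | uncolour-just ψb
    ... | Ra , φa≡c | Rb , φb≡c =
      properG′ a b a~′b (≡.trans φa≡c (≡.sym φb≡c))
      where
      a~′b : T (adj (deleteEdgesAt G R) a b)
      a~′b = subst₂ (λ x y → T (adj G a b ∧ (not x ∧ not y))) (≡.sym Ra) (≡.sym Rb)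
                    (Equivalence.from T-∧ (a~b , tt))

    diverse′ : ∀ y → Diverse (seen (uncolour R φ) y)
    diverse′ y rewrite mapMaybe-if R φ (nbrs G y) with R y in Ry
    ... | true  = diverse-short (map φ outside) (≤-trans (≤-reflexive (length-map φ outside)) (fewOutside y Ry))
      where outside = filterᵇ (not ∘ R) (nbrs G y)
    ... | false = subst (λ xs → Diverse (map φ xs)) (nbrs-deleteEdgesAt G R y Ry)
                        (subst (λ k → 3 ⊓ k ≤ distinct (map φ nbrsG′)) (≡.sym (length-map φ nbrsG′))
                               (dynamicG′ y))
      where nbrsG′ = nbrs (deleteEdgesAt G R) y

    fromLists′ : ∀ z {c} → uncolour R φ z ≡ just c → c ∈ L z
    fromLists′ z ψz = subst (_∈ L z) (proj₂ (uncolour-just ψz)) (inL z)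

DynChoosable-mono : {k k′ : ℕ} (G : Graph) → k ≤ k′ → DynChoosable k G → DynChoosable k′ G
DynChoosable-mono G k≤k′ choosable L lists =
  choosable L (λ z → proj₁ (lists z) , ≤-trans k≤k′ (proj₂ (lists z)))

minimalBad-irreducible : {G : Graph} → MinimalBad G → (H : Graph) → madLt14/5 H →
                         numV H + numE H < numV G + numE G → (DynChoosable 7 H → DynChoosable 7 G) → ⊥
minimalBad-irreducible ((_ , chG) , minimal) H madH smaller lift = <⇒≱ smaller (minimal H (madH , chH))
  where
  chH : ch3d≥ H 8
  chH k k<8 = chG 7 ≤-refl ∘ lift ∘ DynChoosable-mono H (≤-pred k<8)

q*1+w*3≤6 : {q w : ℕ} → q + w ≤ 4 → w ≤ 1 → q * 1 + w * 3 ≤ 6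
q*1+w*3≤6 {q} {w} q+w≤4 w≤1 = begin
  q * 1 + w * 3        ≡⟨ cong₂ _+_ (*-identityʳ q) (*-suc w 2) ⟩
  q + (w + w * 2)      ≡⟨ +-assoc q w (w * 2) ⟨
  (q + w) + w * 2      ≤⟨ +-mono-≤ q+w≤4 (*-monoˡ-≤ 2 w≤1) ⟩
  6                    ∎
  where open ≤-Reasoning

module Cluster (G : Graph) (v : Vertex G) where

  degreeTwo : Vertex G → Bool
  degreeTwo u = isTwo (deg G u)

  cluster : Vertex G → Bool
  cluster z = isYes (z Fin.≟ v) ∨ (adj G v z ∧ degreeTwo z)

  deg2NbrList : List (Vertex G)
  deg2NbrList = filterᵇ degreeTwo (nbrs G v)

  otherNbrs : ℕ
  otherNbrs = length (filterᵇ (not ∘ degreeTwo) (nbrs G v))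

  deg-split : deg G v ≡ deg2Nbrs G v + otherNbrs
  deg-split = ≡.trans (length-filterᵇ-split degreeTwo (nbrs G v))
                      (cong (_+ otherNbrs) (≡.sym (deg2Nbrs-isTwo G v)))

  cluster-v : cluster v ≡ true
  cluster-v with v Fin.≟ v
  ... | yes _  = refl
  ... | no v≢v = ⊥-elim (v≢v refl)

  deg2Nbr-cluster : {z : Vertex G} → T (adj G v z) → T (degreeTwo z) → cluster z ≡ true
  deg2Nbr-cluster {z} v~z d = Equivalence.to T-≡ (Equivalence.from T-∨ (inj₂ (Equivalence.from T-∧ (v~z , d))))

  cluster-cases : (z : Vertex G) → cluster z ≡ true → z ≡ v ⊎ z ∈ deg2NbrList
  cluster-cases z inCluster with z Fin.≟ v
  ... | yes z≡v = inj₁ z≡v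
  ... | no _    = inj₂ (∈-filter⁺ (T? ∘ degreeTwo) (∈-nbrs⁺ G (proj₁ v~z×d)) (proj₂ v~z×d))
    where v~z×d = Equivalence.to T-∧ (Equivalence.from T-≡ inCluster)

  few-outside : otherNbrs ≤ 1 → (y : Vertex G) → cluster y ≡ true →
                length (filterᵇ (not ∘ cluster) (nbrs G y)) ≤ 1
  few-outside other≤1 y inCluster with cluster-cases y inCluster
  ... | inj₁ refl = ≤-trans (length-filterᵇ-mono (nbrs G v) outside⇒other) other≤1
    where
    outside⇒other : ∀ z → z ∈ nbrs G v → T (not (cluster z)) → T (not (degreeTwo z))
    outside⇒other z z∈ outside with T? (degreeTwo z)
    ... | yes d  = ⊥-elim (subst (T ∘ not) (deg2Nbr-cluster (∈-nbrs⁻ G z∈) d) outside)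
    ... | no ¬d = Equivalence.from T-not-≡ (¬-not (¬d ∘ Equivalence.from T-≡))
  ... | inj₂ y∈ = ≤-pred (subst (length (filterᵇ (not ∘ cluster) (nbrs G y)) <_)
                                (isTwo⇒≡2 (proj₂ y∈nbrs×d))
                                (filter-notAll (T? ∘ not ∘ cluster) (nbrs G y) (lose v∈nbrs v-inside)))
    where
    y∈nbrs×d = ∈-filter⁻ (T? ∘ degreeTwo) {xs = nbrs G v} y∈
    v∈nbrs : v ∈ nbrs G y
    v∈nbrs = ∈-nbrs⁺ G (adj-sym G (∈-nbrs⁻ G (proj₁ y∈nbrs×d)))
    v-inside : ¬ T (not (cluster v))
    v-inside = subst (T ∘ not) cluster-v

  fewerEdges : 2 ≤ deg G v → numE (deleteEdgesAt G cluster) < numE G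
  fewerEdges 2≤deg = ⌊n/2⌋-mono (≤-trans (+-monoˡ-≤ _ 2≤deg) (twiceEdges-deleteEdgesAt G cluster v cluster-v))

  module _ (L : Vertex G → List ℕ) where

    open PartialColourings G L

    room-at-v : deg G v ≤ 4 → otherNbrs ≤ 1 → (φ : Vertex G → ℕ) →
                length (forbidden (uncolour cluster φ) v) ≤ 6
    room-at-v deg≤4 other≤1 φ =
      ≤-trans (length-concatMap-≤-split (blocked ψ₀) degreeTwo (nbrs G v) deg2Blocked (length-blocked≤3 ψ₀))
              (q*1+w*3≤6 (subst (_≤ 4) (length-filterᵇ-split degreeTwo (nbrs G v)) deg≤4) other≤1)
      where
      ψ₀ = uncolour cluster φ
      deg2Blocked : ∀ y → y ∈ nbrs G v → T (degreeTwo y) → length (blocked ψ₀ y) ≤ 1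
      deg2Blocked y y∈ d = begin
        length (blocked ψ₀ y)     ≤⟨ length-blocked-uncoloured ψ₀ y (uncolour-inside cluster φ inCluster) ⟩
        length (seen ψ₀ y)        ≡⟨ cong length (mapMaybe-if cluster φ (nbrs G y)) ⟩
        length (map φ outside)    ≡⟨ length-map φ outside ⟩
        length outside            ≤⟨ few-outside other≤1 y inCluster ⟩
        1                         ∎
        where
        open ≤-Reasoning
        inCluster = deg2Nbr-cluster (∈-nbrs⁻ G y∈) d
        outside = filterᵇ (not ∘ cluster) (nbrs G y)

    room-at-deg2Nbr : (∀ z → 7 ≤ length (L z)) → ∀ u → u ∈ deg2NbrList → deg G u * 3 < length (L u)
    room-at-deg2Nbr long u u∈ = subst (λ d → d * 3 < length (L u))
      (≡.sym (isTwo⇒≡2 (proj₂ (∈-filter⁻ (T? ∘ degreeTwo) {xs = nbrs G v} u∈)))) (long u)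

    extend : deg G v ≤ 4 → otherNbrs ≤ 1 → (∀ z → Unique (L z) × 7 ≤ length (L z)) →
             Σ (Vertex G → ℕ) (λ φ → Is3Dynamic (deleteEdgesAt G cluster) φ × (∀ z → φ z ∈ L z)) →
             Σ (Vertex G → ℕ) (λ φ → Is3Dynamic G φ × (∀ z → φ z ∈ L z))
    extend deg≤4 other≤1 lists (φ , dynamic , inL)
      with ψ₁ , valid₁ , ψ₀⊑ψ₁ , v-coloured ←
             colourVertex (uncolour-valid cluster dynamic inL (few-outside other≤1)) v (proj₁ (lists v))
                          (≤-trans (s≤s (room-at-v deg≤4 other≤1 φ)) (proj₂ (lists v)))
      with ψ₂ , valid₂ , ψ₁⊑ψ₂ , deg2Nbrs-coloured ←
             colourAll valid₁ (proj₁ ∘ lists) deg2NbrList (room-at-deg2Nbr (proj₂ ∘ lists))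
      = total⇒3Dynamic valid₂ allColoured
      where
      allColoured : ∀ z → Coloured ψ₂ z
      allColoured z with cluster z in inCluster
      ... | false = φ z , ψ₁⊑ψ₂ z (ψ₀⊑ψ₁ z (uncolour-outside cluster φ inCluster))
      ... | true with cluster-cases z inCluster
      ...   | inj₁ refl = ⊑-Coloured ψ₁⊑ψ₂ v-coloured
      ...   | inj₂ z∈   = deg2Nbrs-coloured z z∈

  cluster-reducible : deg G v ≤ 4 → otherNbrs ≤ 1 → DynChoosable 7 (deleteEdgesAt G cluster) → DynChoosable 7 G
  cluster-reducible deg≤4 other≤1 choosable L lists = extend L deg≤4 other≤1 lists (choosable L lists)

k∸2<q⇒w≤1 : {k q w : ℕ} → suc (k ∸ 2) ≤ q → k ≡ q + w → w ≤ 1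
k∸2<q⇒w≤1 {k} {q} {w} q>k∸2 k≡q+w = +-cancelˡ-≤ q w 1 (begin
  q + w          ≡⟨ k≡q+w ⟨
  k              ≤⟨ m≤n+m∸n k 2 ⟩
  2 + (k ∸ 2)    ≤⟨ s≤s q>k∸2 ⟩
  suc q          ≡⟨ +-comm 1 q ⟩
  q + 1          ∎)
  where open ≤-Reasoning

3or4-bounds : {k : ℕ} → k ≡ 3 ⊎ k ≡ 4 → 2 ≤ k × k ≤ 4
3or4-bounds (inj₁ refl) = s≤s (s≤s z≤n) , n≤1+n 3
3or4-bounds (inj₂ refl) = s≤s (s≤s z≤n) , ≤-refl

lemma4p1 : (G : Graph) → MinimalBad G → (k : ℕ) → (k ≡ 3 ⊎ k ≡ 4) →
           (v : Fin (n G)) → deg G v ≡ k → deg2Nbrs G v ≤ k ∸ 2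
lemma4p1 G minimal k k∈34 v degv with deg2Nbrs G v ≤? k ∸ 2 | 3or4-bounds k∈34
... | yes few | _         = few
... | no many | 2≤k , k≤4 =
  ⊥-elim (minimalBad-irreducible minimal (deleteEdgesAt G cluster)
            (deleteEdgesAt-mad G cluster (proj₁ (proj₁ minimal))) smaller (cluster-reducible deg≤4 other≤1))
  where
  open Cluster G v

  deg≤4 : deg G v ≤ 4
  deg≤4 = subst (_≤ 4) (≡.sym degv) k≤4

  other≤1 : otherNbrs ≤ 1
  other≤1 = k∸2<q⇒w≤1 (≰⇒> many) (≡.trans (≡.sym degv) deg-split)

  smaller : numV (deleteEdgesAt G cluster) + numE (deleteEdgesAt G cluster) < numV G + numE G
  smaller = +-monoʳ-< (n G) (fewerEdges (subst (2 ≤_) (≡.sym degv) 2≤k))
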